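{- Let $n$ and $m$ be positive integers with $n-1\leq m\leq \binom{n}{2}-1$, and let $k$ be the integer satisfying $\binom{k}{2}+(n-k)(k-1)< m\leq \binom{k}{2}+(n-k)k$. Then the minimum of $T(G)$ over all connected graphs $G$ with $n$ vertices and $m$ edges equals $\frac{k+1}{n-k}$.
   Context: All graphs are finite and simple. For a graph $G$, $\omega(G)$ denotes the number of components of $G$ and $\tau(G)$ the order (number of vertices) of a largest component of $G$. A vertex cut of $G$ is a set $X\subset V(G)$ with $\omega(G-X)>1$. The tenacity of a noncomplete connected graph $G$ is $T(G)=\min\left\{\frac{|X|+\tau(G-X)}{\omega(G-X)} : X\subset V(G),\ \omega(G-X)>1\right\}$. (For $n-1\le m\le\binom n2-1$ there is exactly one integer $k$ satisfying the stated inequalities, since the intervals $\left(\binom{k}{2}+(n-k)(k-1),\ \binom{k}{2}+(n-k)k\right]$ are consecutive.) -}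

module Defs where

open import Data.Nat using (ℕ; zero; suc; _+_; _*_; _∸_; _≤_; _<_; _⊔_; _<ᵇ_; _≡ᵇ_)
open import Data.Bool using (Bool; true; false; _∧_; _∨_; not; if_then_else_)
open import Data.Fin using (Fin; toℕ) renaming (zero to fzero; suc to fsuc)
open import Data.Product using (Σ; _×_; _,_)
open import Relation.Binary.PropositionalEquality using (_≡_)

record Graph (n : ℕ) : Set where
  field
    adj    : Fin n → Fin n → Bool
    sym    : ∀ u v → adj u v ≡ adj v u
    irrefl : ∀ v → adj v v ≡ false
open Graph public

VSet : ℕ → Set
VSet n = Fin n → Bool

count : ∀ {n} → (Fin n → Bool) → ℕ
count {zero}  p = 0
count {suc n} p = (if p fzero then 1 else 0) + count (λ i → p (fsuc i))

anyF : ∀ {n} → (Fin n → Bool) → Bool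
anyF {zero}  p = false
anyF {suc n} p = p fzero ∨ anyF (λ i → p (fsuc i))

maxF : ∀ {n} → (Fin n → ℕ) → ℕ
maxF {zero}  f = 0
maxF {suc n} f = f fzero ⊔ maxF (λ i → f (fsuc i))

sumF : ∀ {k} → (Fin k → ℕ) → ℕ
sumF {zero}  f = 0
sumF {suc k} f = f fzero + sumF (λ i → f (fsuc i))

edgeCount : ∀ {n} → Graph n → ℕ
edgeCount G = sumF (λ i → count (λ j → (toℕ i <ᵇ toℕ j) ∧ adj G i j))

reachWithin : ∀ {n} → Graph n → VSet n → ℕ → Fin n → Fin n → Bool
reachWithin G S zero    u v = S u ∧ S v ∧ (toℕ u ≡ᵇ toℕ v)
reachWithin G S (suc t) u v =
  reachWithin G S t u v ∨ anyF (λ w → reachWithin G S t u w ∧ adj G w v ∧ S v)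

-- u and v lie in the same component of G[S] (paths have at most n - 1 edges)
reach : ∀ {n} → Graph n → VSet n → Fin n → Fin n → Bool
reach {n} G S u v = reachWithin G S n u v

-- ω(G[S]): number of components, counted by their least-indexed vertex
ω : ∀ {n} → Graph n → VSet n → ℕ
ω G S = count (λ v → S v ∧ not (anyF (λ u → (toℕ u <ᵇ toℕ v) ∧ reach G S u v)))

τ : ∀ {n} → Graph n → VSet n → ℕ
τ G S = maxF (λ v → if S v then count (reach G S v) else 0)

-- G - X is the subgraph induced by the complement of X
minus : ∀ {n} → VSet n → VSet n
minus X v = not (X v)

Connected : ∀ {n} → Graph n → Set
Connected G = ∀ u v → reach G (λ _ → true) u v ≡ true

IsCut : ∀ {n} → Graph n → VSet n → Set
IsCut G X = 1 < ω G (minus X)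

-- T(G) ≥ p / q  (q > 0), i.e. every cut X has (|X| + τ(G-X)) / ω(G-X) ≥ p / q
TenacityGE : ∀ {n} → Graph n → ℕ → ℕ → Set
TenacityGE G p q = ∀ X → IsCut G X → p * ω G (minus X) ≤ (count X + τ G (minus X)) * q

-- T(G) = p / q  (q > 0): p / q is the minimum over all vertex cuts
HasTenacity : ∀ {n} → Graph n → ℕ → ℕ → Set
HasTenacity G p q =
  TenacityGE G p q ×
  Σ (VSet _) (λ X → IsCut G X × ((count X + τ G (minus X)) * q ≡ p * ω G (minus X)))

module Submission where

-- Write n = k + r and let X be a cut with s vertices, leaving N = n - s vertices in ω components of
-- order at most τ. The edge bound m > C(k,2) + r(k - 1) says that there are M < C(r + 1, 2) non-edges.
-- The least vertices of the components are pairwise non-adjacent, so C(ω,2) ≤ M; and every vertex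
-- of G - X is non-adjacent to the at least N - τ vertices outside its component, so N(N - τ) ≤ 2M. If (s + τ) r < (k + 1) ω,
-- then ω > r contradicts the first count, while ω ≤ r forces N ≥ τ + r and hence 2M ≥ N r ≥ (r + 1) r. Equality holds for a k-clique joined to r independent vertices (all clique
-- vertices but one see all of them, the last sees just enough to reach m edges): deleting the clique
-- leaves r isolated vertices.

open import Defs hiding (sym)
open import Data.Nat using (ℕ; zero; suc; _+_; _*_; _∸_; _≤_; _<_; _<ᵇ_; _≡ᵇ_; z≤n; s≤s)
open import Data.Nat.Properties
open import Data.Nat.Combinatorics using (_C_; nCk+nC[k+1]≡[n+1]C[k+1]; nC1≡n)
open import Data.Nat.Tactic.RingSolver using (solve-∀)
open import Data.Bool using (Bool; true; false; T; _∧_; _∨_; not; if_then_else_)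
open import Data.Bool.Properties using (∨-zeroʳ; ∨-identityʳ; ∧-zeroʳ; ∧-identityʳ; ∧-comm)
open import Data.Fin using (Fin; toℕ; fromℕ<) renaming (zero to fzero; suc to fsuc)
open import Data.Fin.Properties using (toℕ-injective; toℕ-fromℕ<; toℕ<n)
open import Data.Product using (Σ; _×_; _,_)
open import Data.Sum using (_⊎_; inj₁; inj₂)
open import Data.Empty using (⊥-elim)
open import Relation.Nullary using (yes; no)
open import Relation.Binary.PropositionalEquality
  using (_≡_; _≢_; refl; sym; trans; cong; cong₂; subst; subst₂; module ≡-Reasoning)

∧-trueˡ : ∀ a {b} → a ∧ b ≡ true → a ≡ true
∧-trueˡ true _ = refl

∧-trueʳ : ∀ a {b} → a ∧ b ≡ true → b ≡ true
∧-trueʳ true h = h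

∧-true : ∀ {a b} → a ≡ true → b ≡ true → a ∧ b ≡ true
∧-true refl refl = refl

true≢false : true ≢ false
true≢false ()

not-true : ∀ {a} → not a ≡ true → a ≡ false
not-true {false} _ = refl

≡ᵇ-refl : ∀ a → (a ≡ᵇ a) ≡ true
≡ᵇ-refl zero    = refl
≡ᵇ-refl (suc a) = ≡ᵇ-refl a

≡ᵇ-sym : ∀ a b → (a ≡ᵇ b) ≡ (b ≡ᵇ a)
≡ᵇ-sym zero    zero    = refl
≡ᵇ-sym zero    (suc b) = refl
≡ᵇ-sym (suc a) zero    = refl
≡ᵇ-sym (suc a) (suc b) = ≡ᵇ-sym a b

≡ᵇ-true⇒≡ : ∀ a b → (a ≡ᵇ b) ≡ true → a ≡ b
≡ᵇ-true⇒≡ a b h = ≡ᵇ⇒≡ a b (subst T (sym h) _)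

<⇒<ᵇ-true : ∀ {a b} → a < b → (a <ᵇ b) ≡ true
<⇒<ᵇ-true {zero}  {suc b} _         = refl
<⇒<ᵇ-true {suc a} {suc b} (s≤s a<b) = <⇒<ᵇ-true a<b

<ᵇ-true⇒≡ᵇ-false : ∀ a b → (a <ᵇ b) ≡ true → (a ≡ᵇ b) ≡ false
<ᵇ-true⇒≡ᵇ-false zero    (suc b) _ = refl
<ᵇ-true⇒≡ᵇ-false (suc a) (suc b) h = <ᵇ-true⇒≡ᵇ-false a b h

<ᵇ-false-both⇒≡ : ∀ a b → (a <ᵇ b) ≡ false → (b <ᵇ a) ≡ false → a ≡ b
<ᵇ-false-both⇒≡ zero    zero    _  _  = refl
<ᵇ-false-both⇒≡ (suc a) (suc b) h₁ h₂ = cong suc (<ᵇ-false-both⇒≡ a b h₁ h₂)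

count-cong : ∀ {n} {p q : Fin n → Bool} → (∀ i → p i ≡ q i) → count p ≡ count q
count-cong {zero}  e = refl
count-cong {suc n} {p} e rewrite e fzero = cong (_ +_) (count-cong (λ i → e (fsuc i)))

count-false : ∀ n → count {n} (λ _ → false) ≡ 0
count-false zero    = refl
count-false (suc n) = count-false n

count-true : ∀ n → count {n} (λ _ → true) ≡ n
count-true zero    = refl
count-true (suc n) = cong suc (count-true n)

count-mono : ∀ {n} {p q : Fin n → Bool} → (∀ i → p i ≡ true → q i ≡ true) → count p ≤ count q
count-mono {zero}  _ = z≤n
count-mono {suc n} {p} {q} h with p fzero in ep | q fzero in eq
... | false | false = count-mono (λ i → h (fsuc i))
... | false | true  = m≤n⇒m≤1+n (count-mono (λ i → h (fsuc i)))
... | true  | true  = s≤s (count-mono (λ i → h (fsuc i)))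
... | true  | false with () ← trans (sym (h fzero ep)) eq

count-split : ∀ {n} (p q : Fin n → Bool) →
  count p ≡ count (λ i → p i ∧ q i) + count (λ i → p i ∧ not (q i))
count-split {zero}  p q = refl
count-split {suc n} p q with p fzero | q fzero
... | false | _     = count-split (λ i → p (fsuc i)) (λ i → q (fsuc i))
... | true  | true  = cong suc (count-split (λ i → p (fsuc i)) (λ i → q (fsuc i)))
... | true  | false =
  trans (cong suc (count-split (λ i → p (fsuc i)) (λ i → q (fsuc i)))) (sym (+-suc _ _))

count-complement : ∀ {n} (p : Fin n → Bool) → count p + count (λ i → not (p i)) ≡ n
count-complement {zero}  p = refl
count-complement {suc n} p with p fzero
... | true  = cong suc (count-complement (λ i → p (fsuc i)))
... | false = trans (+-suc _ _) (cong suc (count-complement (λ i → p (fsuc i))))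

count-∨ : ∀ {n} (p q : Fin n → Bool) → count (λ i → p i ∨ q i) ≤ count p + count q
count-∨ {zero}  p q = z≤n
count-∨ {suc n} p q with p fzero | q fzero
... | true  | true  = s≤s (≤-trans rest (≤-trans (m≤n+m _ 1) (≤-reflexive (sym (+-suc _ _)))))
  where rest = count-∨ (λ i → p (fsuc i)) (λ i → q (fsuc i))
... | true  | false = s≤s (count-∨ (λ i → p (fsuc i)) (λ i → q (fsuc i)))
... | false | true  =
  ≤-trans (s≤s (count-∨ (λ i → p (fsuc i)) (λ i → q (fsuc i)))) (≤-reflexive (sym (+-suc _ _)))
... | false | false = count-∨ (λ i → p (fsuc i)) (λ i → q (fsuc i))

count-witness : ∀ {n} (p : Fin n → Bool) → 1 ≤ count p → Σ (Fin n) (λ i → p i ≡ true)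
count-witness {suc n} p h with p fzero in e
... | true  = fzero , e
... | false with count-witness (λ i → p (fsuc i)) h
...   | i , e′ = fsuc i , e′

count-pos : ∀ {n} (p : Fin n → Bool) i → p i ≡ true → 1 ≤ count p
count-pos {suc n} p fzero    e rewrite e = s≤s z≤n
count-pos {suc n} p (fsuc i) e = ≤-trans (count-pos (λ j → p (fsuc j)) i e) (m≤n+m _ _)

count-<ᵇ : ∀ n c → c ≤ n → count {n} (λ i → toℕ i <ᵇ c) ≡ c
count-<ᵇ n       zero    _         = count-false n
count-<ᵇ (suc n) (suc c) (s≤s c≤n) = cong suc (count-<ᵇ n c c≤n)

count-≡ᵇ≤1 : ∀ {n} (v : Fin n) → count {n} (λ u → toℕ v ≡ᵇ toℕ u) ≤ 1
count-≡ᵇ≤1 {suc n} fzero    = ≤-reflexive (cong suc (count-false n))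
count-≡ᵇ≤1 {suc n} (fsuc v) = count-≡ᵇ≤1 v

anyF-intro : ∀ {n} (p : Fin n → Bool) i → p i ≡ true → anyF p ≡ true
anyF-intro p fzero    e rewrite e = refl
anyF-intro p (fsuc i) e rewrite anyF-intro (λ j → p (fsuc j)) i e = ∨-zeroʳ (p fzero)

anyF-false : ∀ {n} (p : Fin n → Bool) → (∀ i → p i ≡ false) → anyF p ≡ false
anyF-false {zero}  p h = refl
anyF-false {suc n} p h rewrite h fzero = anyF-false (λ j → p (fsuc j)) (λ j → h (fsuc j))

maxF-upper : ∀ {n} (f : Fin n → ℕ) i → f i ≤ maxF f
maxF-upper f fzero    = m≤m⊔n _ _
maxF-upper f (fsuc i) = ≤-trans (maxF-upper (λ j → f (fsuc j)) i) (m≤n⊔m (f fzero) _)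

maxF-least : ∀ {n} (f : Fin n → ℕ) b → (∀ i → f i ≤ b) → maxF f ≤ b
maxF-least {zero}  f b h = z≤n
maxF-least {suc n} f b h = ⊔-lub (h fzero) (maxF-least (λ j → f (fsuc j)) b (λ j → h (fsuc j)))

sumF-cong : ∀ {n} {f g : Fin n → ℕ} → (∀ i → f i ≡ g i) → sumF f ≡ sumF g
sumF-cong {zero}  e = refl
sumF-cong {suc n} e = cong₂ _+_ (e fzero) (sumF-cong (λ i → e (fsuc i)))

sumF-mono : ∀ {n} {f g : Fin n → ℕ} → (∀ i → f i ≤ g i) → sumF f ≤ sumF g
sumF-mono {zero}  e = z≤n
sumF-mono {suc n} e = +-mono-≤ (e fzero) (sumF-mono (λ i → e (fsuc i)))

+-middle-swap : ∀ a b c d → a + b + (c + d) ≡ a + c + (b + d)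
+-middle-swap = solve-∀

sumF-+ : ∀ {n} (f g : Fin n → ℕ) → sumF (λ i → f i + g i) ≡ sumF f + sumF g
sumF-+ {zero}  f g = refl
sumF-+ {suc n} f g = trans (cong (f fzero + g fzero +_) (sumF-+ (λ i → f (fsuc i)) (λ i → g (fsuc i))))
                           (+-middle-swap (f fzero) (g fzero) _ _)

sumF-if : ∀ {n} (p : Fin n → Bool) c → sumF (λ i → if p i then c else 0) ≡ count p * c
sumF-if {zero}  p c = refl
sumF-if {suc n} p c with p fzero
... | true  = cong (c +_) (sumF-if (λ i → p (fsuc i)) c)
... | false = sumF-if (λ i → p (fsuc i)) c

sumF-indicator : ∀ {n} (p : Fin n → Bool) → sumF (λ i → if p i then 1 else 0) ≡ count p
sumF-indicator p = trans (sumF-if p 1) (*-identityʳ _)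

countPairs : ∀ {n} → (Fin n → Fin n → Bool) → ℕ
countPairs f = sumF (λ i → count (f i))

countPairs-cong : ∀ {n} {f g : Fin n → Fin n → Bool} → (∀ i j → f i j ≡ g i j) → countPairs f ≡ countPairs g
countPairs-cong e = sumF-cong (λ i → count-cong (e i))

countPairs-mono : ∀ {n} {f g : Fin n → Fin n → Bool} →
  (∀ i j → f i j ≡ true → g i j ≡ true) → countPairs f ≤ countPairs g
countPairs-mono e = sumF-mono (λ i → count-mono (e i))

countPairs-∨ : ∀ {n} (f g : Fin n → Fin n → Bool) →
  countPairs (λ i j → f i j ∨ g i j) ≤ countPairs f + countPairs g
countPairs-∨ f g = ≤-trans (sumF-mono (λ i → count-∨ (f i) (g i)))
                           (≤-reflexive (sumF-+ (λ i → count (f i)) (λ i → count (g i))))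

countPairs-split : ∀ {n} (f g : Fin n → Fin n → Bool) →
  countPairs f ≡ countPairs (λ i j → f i j ∧ g i j) + countPairs (λ i j → f i j ∧ not (g i j))
countPairs-split f g = trans (sumF-cong (λ i → count-split (f i) (g i)))
                             (sumF-+ (λ i → count (λ j → f i j ∧ g i j)) (λ i → count (λ j → f i j ∧ not (g i j))))

countPairs-suc : ∀ {n} (f : Fin (suc n) → Fin (suc n) → Bool) →
  countPairs f ≡ (if f fzero fzero then 1 else 0) + count (λ j → f fzero (fsuc j))
               + (count (λ i → f (fsuc i) fzero) + countPairs (λ i j → f (fsuc i) (fsuc j)))
countPairs-suc f =
  cong ((if f fzero fzero then 1 else 0) + count (λ j → f fzero (fsuc j)) +_)
       (trans (sumF-+ (λ i → if f (fsuc i) fzero then 1 else 0) (λ i → count (λ j → f (fsuc i) (fsuc j))))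
              (cong (_+ countPairs (λ i j → f (fsuc i) (fsuc j))) (sumF-indicator (λ i → f (fsuc i) fzero))))

countPairs-transpose : ∀ {n} (f : Fin n → Fin n → Bool) → countPairs f ≡ countPairs (λ i j → f j i)
countPairs-transpose {zero}  f = refl
countPairs-transpose {suc n} f = begin
  countPairs f                                 ≡⟨ countPairs-suc f ⟩
  diag + row + (col + rest)                    ≡⟨ cong (λ x → diag + row + (col + x)) (countPairs-transpose (λ i j → f (fsuc i) (fsuc j))) ⟩
  diag + row + (col + countPairs (λ i j → f (fsuc j) (fsuc i)))
                                               ≡⟨ +-middle-swap diag row col _ ⟩
  diag + col + (row + countPairs (λ i j → f (fsuc j) (fsuc i)))
                                               ≡⟨ sym (countPairs-suc (λ i j → f j i)) ⟩
  countPairs (λ i j → f j i)                   ∎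
  where
  open ≡-Reasoning
  diag = if f fzero fzero then 1 else 0
  row  = count (λ j → f fzero (fsuc j))
  col  = count (λ i → f (fsuc i) fzero)
  rest = countPairs (λ i j → f (fsuc i) (fsuc j))

choose2 : ℕ → ℕ
choose2 zero    = 0
choose2 (suc n) = n + choose2 n

choose2≡C2 : ∀ n → choose2 n ≡ n C 2
choose2≡C2 zero    = refl
choose2≡C2 (suc n) = trans (cong₂ _+_ (sym (nC1≡n n)) (choose2≡C2 n)) (nCk+nC[k+1]≡[n+1]C[k+1] n 1)

choose2-mono : ∀ {a b} → a ≤ b → choose2 a ≤ choose2 b
choose2-mono {zero}              _         = z≤n
choose2-mono {suc a} {suc b} (s≤s a≤b) = +-mono-≤ a≤b (choose2-mono a≤b)

choose2-+ : ∀ a b → choose2 (a + b) ≡ choose2 a + a * b + choose2 b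
choose2-+ a zero rewrite +-identityʳ a | *-zeroʳ a = sym (trans (+-identityʳ _) (+-identityʳ _))
choose2-+ a (suc b) rewrite +-suc a b | choose2-+ a b = shuffle a b (choose2 a) (choose2 b)
  where
  shuffle : ∀ a b x y → a + b + (x + a * b + y) ≡ x + a * suc b + (b + y)
  shuffle = solve-∀

choose2-suc-double : ∀ r → choose2 (suc r) * 2 ≡ suc r * r
choose2-suc-double zero    = refl
choose2-suc-double (suc r) = begin
  (suc r + choose2 (suc r)) * 2    ≡⟨ *-distribʳ-+ 2 (suc r) (choose2 (suc r)) ⟩
  suc r * 2 + choose2 (suc r) * 2  ≡⟨ cong (suc r * 2 +_) (choose2-suc-double r) ⟩
  suc r * 2 + suc r * r            ≡⟨ expand r ⟩
  suc (suc r) * suc r              ∎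
  where
  open ≡-Reasoning
  expand : ∀ r → suc r * 2 + suc r * r ≡ suc (suc r) * suc r
  expand = solve-∀

-- Unless t + r ≤ N the tenacity bound (s + t) r ≥ K w holds outright; otherwise each of the N
-- vertices misses at least N - t ≥ r others, so 2M ≥ N r ≥ (r + 1) r.
manyNonEdges : ∀ K r s N t w M →
  suc (s + N) ≡ K + r → N * N ≤ M * 2 + N * t → (1 ≤ N → 1 ≤ t) →
  w ≤ r → (s + t) * r < K * w → choose2 (suc r) ≤ M
manyNonEdges K zero    s N t w M _ _ _ _ _ = z≤n
manyNonEdges K (suc r′) s N t w M sizes pairs t-pos w≤r small = *-cancelʳ-≤ _ _ 2 (begin
  choose2 (suc r) * 2  ≡⟨ choose2-suc-double r ⟩
  suc r * r            ≤⟨ *-monoˡ-≤ r r<N ⟩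
  N * r                ≤⟨ N*r≤2M ⟩
  M * 2                ∎)
  where
  open ≤-Reasoning
  r = suc r′
  t+r≤N : t + r ≤ N
  t+r≤N with t + r ≤? N
  ... | yes le = le
  ... | no  gt = ⊥-elim (<⇒≱ small (≤-trans (*-monoˡ-≤ w K≤s+t) (*-monoʳ-≤ (s + t) w≤r)))
    where
    K≤s+t : K ≤ s + t
    K≤s+t = +-cancelʳ-≤ r K (s + t) (begin
      K + r          ≡⟨ sym sizes ⟩
      suc (s + N)    ≡⟨ sym (+-suc s N) ⟩
      s + suc N      ≤⟨ +-monoʳ-≤ s (≰⇒> gt) ⟩
      s + (t + r)    ≡⟨ sym (+-assoc s t r) ⟩
      s + t + r      ∎)
  r<N : suc r ≤ N
  r<N = ≤-trans (+-monoˡ-≤ r (t-pos (≤-trans (s≤s z≤n) (≤-trans (m≤n+m r t) t+r≤N)))) t+r≤N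
  N*r≤2M : N * r ≤ M * 2
  N*r≤2M = +-cancelˡ-≤ (N * t) _ _ (begin
    N * t + N * r   ≡⟨ sym (*-distribˡ-+ N t r) ⟩
    N * (t + r)     ≤⟨ *-monoʳ-≤ N t+r≤N ⟩
    N * N           ≤⟨ pairs ⟩
    M * 2 + N * t   ≡⟨ +-comm (M * 2) (N * t) ⟩
    N * t + M * 2   ∎)

fewNonEdges : ∀ k′ r m M → choose2 (suc k′) + r * k′ < m → m + M ≡ choose2 (suc k′ + r) → M < choose2 (suc r)
fewNonEdges k′ r m M many total = +-cancelˡ-< A M (choose2 (suc r)) (begin-strict
  A + M                    <⟨ +-monoˡ-< M many ⟩
  m + M                    ≡⟨ total ⟩
  choose2 (suc k′ + r)     ≡⟨ choose2-+ (suc k′) r ⟩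
  choose2 (suc k′) + suc k′ * r + choose2 r   ≡⟨ regroup (choose2 (suc k′)) k′ r (choose2 r) ⟩
  A + choose2 (suc r)      ∎)
  where
  open ≤-Reasoning
  A = choose2 (suc k′) + r * k′
  regroup : ∀ a k r b → a + suc k * r + b ≡ a + r * k + (r + b)
  regroup = solve-∀

-- Either ω > r, and the C(ω,2) non-edges between components are too many, or manyNonEdges applies.
tenacityInequality : ∀ k′ r s N t w m M →
  s + N ≡ suc k′ + r → choose2 (suc k′) + r * k′ < m → m + M ≡ choose2 (suc k′ + r) →
  choose2 w ≤ M → N * N ≤ M * 2 + N * t → (1 ≤ N → 1 ≤ t) →
  (suc k′ + 1) * w ≤ (s + t) * r
tenacityInequality k′ r s N t w m M sizes many total components pairs t-pos
  with (suc k′ + 1) * w ≤? (s + t) * r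
... | yes le = le
... | no  gt = ⊥-elim (<⇒≱ (fewNonEdges k′ r m M many total) enough)
  where
  enough : choose2 (suc r) ≤ M
  enough with w ≤? r
  ... | yes w≤r = manyNonEdges (suc k′ + 1) r s N t w M sizes′ pairs t-pos w≤r (≰⇒> gt)
    where
    sizes′ : suc (s + N) ≡ suc k′ + 1 + r
    sizes′ = trans (cong suc sizes) (cong (_+ r) (+-comm 1 (suc k′)))
  ... | no  r<w = ≤-trans (choose2-mono (≰⇒> r<w)) components

module _ {n} (G : Graph n) (S : VSet n) where

  reachWithin-refl : ∀ t v → S v ≡ true → reachWithin G S t v v ≡ true
  reachWithin-refl zero    v e rewrite e = ≡ᵇ-refl (toℕ v)
  reachWithin-refl (suc t) v e rewrite reachWithin-refl t v e = refl

  reachWithin-suc : ∀ t u v → reachWithin G S t u v ≡ true → reachWithin G S (suc t) u v ≡ true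
  reachWithin-suc t u v h rewrite h = refl

  reachWithin-step : ∀ t u w v → reachWithin G S t u w ≡ true → adj G w v ≡ true → S v ≡ true →
    reachWithin G S (suc t) u v ≡ true
  reachWithin-step t u w v h a s =
    trans (cong (reachWithin G S t u v ∨_) (anyF-intro _ w (∧-true h (∧-true a s)))) (∨-zeroʳ _)

  reach-refl : ∀ v → S v ≡ true → reach G S v v ≡ true
  reach-refl = reachWithin-refl n

adj⇒reach : ∀ {n} (G : Graph n) (S : VSet n) u v → S u ≡ true → S v ≡ true → adj G u v ≡ true →
  reach G S u v ≡ true
adj⇒reach {suc n} G S u v su sv a = reachWithin-step G S n u u v (reachWithin-refl G S n u su) a sv

countPairs-within : ∀ {n} (R : Fin n → Bool) →
  countPairs (λ i j → (toℕ i <ᵇ toℕ j) ∧ (R i ∧ R j)) ≡ choose2 (count R)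
countPairs-within {zero}  R = refl
countPairs-within {suc n} R with R fzero
... | true  = cong (count (λ j → R (fsuc j)) +_) (countPairs-within (λ j → R (fsuc j)))
... | false = trans (cong (_+ countPairs (λ i j → (toℕ i <ᵇ toℕ j) ∧ (R (fsuc i) ∧ R (fsuc j)))) (count-false n))
                    (countPairs-within (λ j → R (fsuc j)))

nonEdgeCount : ∀ {n} → Graph n → ℕ
nonEdgeCount G = countPairs (λ i j → (toℕ i <ᵇ toℕ j) ∧ not (adj G i j))

edgeCount+nonEdgeCount : ∀ {n} (G : Graph n) → edgeCount G + nonEdgeCount G ≡ choose2 n
edgeCount+nonEdgeCount {n} G = begin
  edgeCount G + nonEdgeCount G                        ≡⟨ sym (countPairs-split _<ᵢ_ (adj G)) ⟩
  countPairs _<ᵢ_                                     ≡⟨ countPairs-cong (λ i j → sym (∧-identityʳ (i <ᵢ j))) ⟩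
  countPairs (λ i j → (i <ᵢ j) ∧ (true ∧ true))       ≡⟨ countPairs-within {n} (λ _ → true) ⟩
  choose2 (count {n} (λ _ → true))                    ≡⟨ cong choose2 (count-true n) ⟩
  choose2 n                                           ∎
  where
  open ≡-Reasoning
  _<ᵢ_ : Fin n → Fin n → Bool
  i <ᵢ j = toℕ i <ᵇ toℕ j

module _ {n} (G : Graph n) (S : VSet n) where
  private
    _<ᵢ_ : Fin n → Fin n → Bool
    i <ᵢ j = toℕ i <ᵇ toℕ j

    isRepresentative : Fin n → Bool
    isRepresentative v = S v ∧ not (anyF (λ u → (u <ᵢ v) ∧ reach G S u v))

    unreachable : Fin n → Fin n → Bool
    unreachable v u = S v ∧ (S u ∧ not (reach G S v u))

  -- Distinct components have non-adjacent least vertices.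
  choose2-ω≤nonEdgeCount : choose2 (ω G S) ≤ nonEdgeCount G
  choose2-ω≤nonEdgeCount = ≤-trans (≤-reflexive (sym (countPairs-within isRepresentative)))
                                   (countPairs-mono nonAdjacent)
    where
    nonAdjacent : ∀ i j → (i <ᵢ j) ∧ (isRepresentative i ∧ isRepresentative j) ≡ true →
      (i <ᵢ j) ∧ not (adj G i j) ≡ true
    nonAdjacent i j h with adj G i j in a
    ... | false = ∧-true (∧-trueˡ (i <ᵢ j) h) refl
    ... | true = ⊥-elim (true≢false (trans (sym (anyF-intro _ i (∧-true i<j (adj⇒reach G S i j Si Sj a))))
                                           (not-true (∧-trueʳ (S j) repj))))
      where
      i<j  = ∧-trueˡ (i <ᵢ j) h
      reps = ∧-trueʳ (i <ᵢ j) h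
      Si   = ∧-trueˡ (S i) (∧-trueˡ (isRepresentative i) reps)
      repj = ∧-trueʳ (isRepresentative i) reps
      Sj   = ∧-trueˡ (S j) repj

  -- An unreachable ordered pair is a non-edge, counted once in each orientation.
  unreachable≤nonEdgeCount*2 : countPairs unreachable ≤ nonEdgeCount G * 2
  unreachable≤nonEdgeCount*2 = begin
    countPairs unreachable                ≤⟨ countPairs-mono nonEdgeEitherWay ⟩
    countPairs (λ v u → forward v u ∨ backward v u)  ≤⟨ countPairs-∨ forward backward ⟩
    nonEdgeCount G + countPairs backward  ≡⟨ cong (nonEdgeCount G +_) backward≡forward ⟩
    nonEdgeCount G + nonEdgeCount G       ≡⟨ cong (nonEdgeCount G +_) (sym (+-identityʳ _)) ⟩
    nonEdgeCount G + (nonEdgeCount G + 0) ≡⟨ *-comm 2 (nonEdgeCount G) ⟩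
    nonEdgeCount G * 2                    ∎
    where
    open ≤-Reasoning
    forward backward : Fin n → Fin n → Bool
    forward  v u = (v <ᵢ u) ∧ not (adj G v u)
    backward v u = (u <ᵢ v) ∧ not (adj G v u)
    backward≡forward : countPairs backward ≡ nonEdgeCount G
    backward≡forward = trans (countPairs-transpose backward)
      (countPairs-cong (λ i j → cong (λ b → (i <ᵢ j) ∧ not b) (Graph.sym G j i)))
    nonEdgeEitherWay : ∀ v u → unreachable v u ≡ true → forward v u ∨ backward v u ≡ true
    nonEdgeEitherWay v u h with adj G v u in a
    ... | true = ⊥-elim (true≢false (trans (sym (adj⇒reach G S v u Sv Su a)) (not-true (∧-trueʳ (S u) rest))))
      where
      Sv   = ∧-trueˡ (S v) h
      rest = ∧-trueʳ (S v) h
      Su   = ∧-trueˡ (S u) rest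
    nonEdgeEitherWay v u h | false with v <ᵢ u in vu | u <ᵢ v in uv
    ... | true  | _    = refl
    ... | false | true = refl
    ... | false | false with toℕ-injective (<ᵇ-false-both⇒≡ (toℕ v) (toℕ u) vu uv)
    ...   | refl with () ← trans (sym (reach-refl G S v (∧-trueˡ (S v) h)))
                                 (not-true (∧-trueʳ (S v) (∧-trueʳ (S v) h)))

  component≤τ : ∀ v → S v ≡ true → count (reach G S v) ≤ τ G S
  component≤τ v e = ≤-trans (≤-reflexive (cong (λ b → if b then count (reach G S v) else 0) (sym e)))
                            (maxF-upper (λ v → if S v then count (reach G S v) else 0) v)

  τ-pos : 1 ≤ count S → 1 ≤ τ G S
  τ-pos h with count-witness S h
  ... | v , e = ≤-trans (count-pos (reach G S v) v (reach-refl G S v e)) (component≤τ v e)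

  -- Each of the N vertices of S reaches at most τ vertices and fails to reach the rest.
  count*count≤nonEdgeCount*2+count*τ : count S * count S ≤ nonEdgeCount G * 2 + count S * τ G S
  count*count≤nonEdgeCount*2+count*τ = begin
    count S * count S                                        ≡⟨ sym (sumF-if S (count S)) ⟩
    sumF (λ v → if S v then count S else 0)                  ≤⟨ sumF-mono perVertex ⟩
    sumF (λ v → count (unreachable v) + (if S v then τ G S else 0))
      ≡⟨ sumF-+ (λ v → count (unreachable v)) (λ v → if S v then τ G S else 0) ⟩
    countPairs unreachable + sumF (λ v → if S v then τ G S else 0)
      ≤⟨ +-mono-≤ unreachable≤nonEdgeCount*2 (≤-reflexive (sumF-if S (τ G S))) ⟩
    nonEdgeCount G * 2 + count S * τ G S                     ∎
    where
    open ≤-Reasoning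
    perVertex : ∀ v → (if S v then count S else 0) ≤ count (unreachable v) + (if S v then τ G S else 0)
    perVertex v with S v in e
    ... | false = z≤n
    ... | true  = begin
      count S                          ≡⟨ count-split S (reach G S v) ⟩
      count (λ u → S u ∧ reach G S v u) + count (λ u → S u ∧ not (reach G S v u))
        ≡⟨ +-comm (count (λ u → S u ∧ reach G S v u)) _ ⟩
      count (λ u → S u ∧ not (reach G S v u)) + count (λ u → S u ∧ reach G S v u)
        ≤⟨ +-monoʳ-≤ _ (≤-trans (count-mono (λ u → ∧-trueʳ (S u))) (component≤τ v e)) ⟩
      count (λ u → S u ∧ not (reach G S v u)) + τ G S  ∎

tenacityLowerBound : ∀ {n} (G : Graph n) k′ r → n ≡ suc k′ + r →
  choose2 (suc k′) + r * k′ < edgeCount G → TenacityGE G (suc k′ + 1) r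
tenacityLowerBound G k′ r n≡ many X _ =
  tenacityInequality k′ r (count X) (count S) (τ G S) (ω G S) (edgeCount G) (nonEdgeCount G)
    (trans (count-complement X) n≡) many (trans (edgeCount+nonEdgeCount G) (cong choose2 n≡))
    (choose2-ω≤nonEdgeCount G S) (count*count≤nonEdgeCount*2+count*τ G S) (τ-pos G S)
  where
  S = minus X

<ᵇ-true⇒< : ∀ a b → (a <ᵇ b) ≡ true → a < b
<ᵇ-true⇒< a b h = <ᵇ⇒< a b (subst T (sym h) _)

<ᵇ-above-below : ∀ a b k → (a <ᵇ k) ≡ false → (b <ᵇ k) ≡ true → (a <ᵇ b) ≡ false
<ᵇ-above-below a       zero    (suc k) _  _  = refl
<ᵇ-above-below (suc a) (suc b) (suc k) h₁ h₂ = <ᵇ-above-below a b k h₁ h₂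

<ᵇ-below-above : ∀ a b k → (a <ᵇ k) ≡ true → (b <ᵇ k) ≡ false → (a <ᵇ b) ≡ true
<ᵇ-below-above zero    (suc b) (suc k) _  _  = refl
<ᵇ-below-above (suc a) (suc b) (suc k) h₁ h₂ = <ᵇ-below-above a b k h₁ h₂

-- The extremal graph on k + r vertices, k = k′ + 1: a clique on {0, …, k - 1} and an independent
-- set of r further vertices, each joined to the clique vertices 1, …, k - 1; vertex 0 is joined only
-- to the first e of them.
module Extremal (k′ r e : ℕ) where
  k n : ℕ
  k = suc k′
  n = k + r

  hubEdge : ℕ → ℕ → Bool
  hubEdge a b = (0 <ᵇ a) ∨ (b <ᵇ k + e)

  adjℕ : ℕ → ℕ → Bool
  adjℕ a b = if a <ᵇ k then (if b <ᵇ k then not (a ≡ᵇ b) else hubEdge a b)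
                       else (if b <ᵇ k then hubEdge b a else false)

  adjℕ-sym : ∀ a b → adjℕ a b ≡ adjℕ b a
  adjℕ-sym a b with a <ᵇ k | b <ᵇ k
  ... | true  | true  = cong not (≡ᵇ-sym a b)
  ... | true  | false = refl
  ... | false | true  = refl
  ... | false | false = refl

  adjℕ-irrefl : ∀ a → adjℕ a a ≡ false
  adjℕ-irrefl a with a <ᵇ k
  ... | true  = cong not (≡ᵇ-refl a)
  ... | false = refl

  G : Graph n
  G = record { adj    = λ u v → adjℕ (toℕ u) (toℕ v)
             ; sym    = λ u v → adjℕ-sym (toℕ u) (toℕ v)
             ; irrefl = λ v → adjℕ-irrefl (toℕ v) }

  inClique : VSet n
  inClique i = toℕ i <ᵇ k

  count-inClique : count inClique ≡ k
  count-inClique = count-<ᵇ n k (m≤m+n k r)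

  count-outside : count (λ i → not (inClique i)) ≡ r
  count-outside = +-cancelˡ-≡ k _ _
    (trans (cong (_+ count (λ i → not (inClique i))) (sym count-inClique)) (count-complement inClique))

  adj-clique-clique : ∀ a b → (a <ᵇ k) ≡ true → (b <ᵇ k) ≡ true → adjℕ a b ≡ not (a ≡ᵇ b)
  adj-clique-clique a b h₁ h₂ rewrite h₁ | h₂ = refl

  adj-outside-clique : ∀ a b → (a <ᵇ k) ≡ false → (b <ᵇ k) ≡ true → adjℕ a b ≡ hubEdge b a
  adj-outside-clique a b h₁ h₂ rewrite h₁ | h₂ = refl

  adj-outside-outside : ∀ a b → (a <ᵇ k) ≡ false → (b <ᵇ k) ≡ false → adjℕ a b ≡ false
  adj-outside-outside a b h₁ h₂ rewrite h₁ | h₂ = refl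

  private
    _<ᵢ_ : Fin n → Fin n → Bool
    i <ᵢ j = toℕ i <ᵇ toℕ j

    cliqueEdges : ∀ i j → ((i <ᵢ j) ∧ adj G i j) ∧ inClique j ≡ (i <ᵢ j) ∧ (inClique i ∧ inClique j)
    cliqueEdges i j with inClique i in ei | inClique j in ej
    ... | true  | true with i <ᵢ j in i<j
    ...   | true  rewrite <ᵇ-true⇒≡ᵇ-false (toℕ i) (toℕ j) i<j = refl
    ...   | false = refl
    cliqueEdges i j | true  | false = trans (∧-zeroʳ _) (sym (∧-zeroʳ _))
    cliqueEdges i j | false | true  rewrite <ᵇ-above-below (toℕ i) (toℕ j) k ei ej = refl
    cliqueEdges i j | false | false = trans (∧-zeroʳ _) (sym (∧-zeroʳ _))

    crossing : Fin n → Fin n → Bool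
    crossing i j = inClique i ∧ (not (inClique j) ∧ hubEdge (toℕ i) (toℕ j))

    crossingEdges : ∀ i j → ((i <ᵢ j) ∧ adj G i j) ∧ not (inClique j) ≡ crossing i j
    crossingEdges i j with inClique i in ei | inClique j in ej
    ... | true  | true  = ∧-zeroʳ _
    ... | true  | false rewrite <ᵇ-below-above (toℕ i) (toℕ j) k ei ej = ∧-identityʳ _
    ... | false | true  = ∧-zeroʳ _
    ... | false | false = trans (∧-identityʳ _) (∧-zeroʳ _)

    firstOutside : e ≤ r → count (λ j → not (inClique j) ∧ (toℕ j <ᵇ k + e)) ≡ e
    firstOutside e≤r = +-cancelˡ-≡ k _ _ (begin
      k + count (λ j → not (inClique j) ∧ below j)
        ≡⟨ cong₂ _+_ (sym belowClique) (count-cong (λ j → ∧-comm (not (inClique j)) (below j))) ⟩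
      count (λ j → below j ∧ inClique j) + count (λ j → below j ∧ not (inClique j))
        ≡⟨ sym (count-split below inClique) ⟩
      count below
        ≡⟨ count-<ᵇ n (k + e) (+-monoʳ-≤ k e≤r) ⟩
      k + e ∎)
      where
      open ≡-Reasoning
      below : VSet n
      below j = toℕ j <ᵇ k + e
      belowClique : count (λ j → below j ∧ inClique j) ≡ k
      belowClique = trans (count-cong clique⇒below) count-inClique
        where
        clique⇒below : ∀ j → below j ∧ inClique j ≡ inClique j
        clique⇒below j with inClique j in ej
        ... | true  rewrite <⇒<ᵇ-true (≤-trans (<ᵇ-true⇒< (toℕ j) k ej) (m≤m+n k e)) = refl
        ... | false = ∧-zeroʳ _

    crossingCount : e ≤ r → countPairs crossing ≡ e + k′ * r
    crossingCount e≤r = cong₂ _+_ (firstOutside e≤r) (begin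
      sumF (λ i → count (crossing (fsuc i)))          ≡⟨ sumF-cong hubRow ⟩
      sumF {k′ + r} (λ i → if toℕ i <ᵇ k′ then r else 0)  ≡⟨ sumF-if {k′ + r} (λ i → toℕ i <ᵇ k′) r ⟩
      count {k′ + r} (λ i → toℕ i <ᵇ k′) * r          ≡⟨ cong (_* r) (count-<ᵇ (k′ + r) k′ (m≤m+n k′ r)) ⟩
      k′ * r                                          ∎)
      where
      open ≡-Reasoning
      hubRow : ∀ (i : Fin (k′ + r)) → count (crossing (fsuc i)) ≡ (if toℕ i <ᵇ k′ then r else 0)
      hubRow i with toℕ i <ᵇ k′
      ... | true  = trans (count-cong (λ j → ∧-identityʳ (not (inClique j)))) count-outside
      ... | false = count-false n

  edgeCount-G : e ≤ r → edgeCount G ≡ choose2 k + r * k′ + e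
  edgeCount-G e≤r = begin
    edgeCount G
      ≡⟨ countPairs-split (λ i j → (i <ᵢ j) ∧ adj G i j) (λ _ j → inClique j) ⟩
    countPairs (λ i j → ((i <ᵢ j) ∧ adj G i j) ∧ inClique j)
      + countPairs (λ i j → ((i <ᵢ j) ∧ adj G i j) ∧ not (inClique j))
      ≡⟨ cong₂ _+_ (trans (countPairs-cong cliqueEdges) (countPairs-within inClique))
                   (trans (countPairs-cong crossingEdges) (crossingCount e≤r)) ⟩
    choose2 (count inClique) + (e + k′ * r)
      ≡⟨ cong (λ c → choose2 c + (e + k′ * r)) count-inClique ⟩
    choose2 k + (e + k′ * r)
      ≡⟨ regroup (choose2 k) e k′ r ⟩
    choose2 k + r * k′ + e ∎
    where
    open ≡-Reasoning
    regroup : ∀ c e k r → c + (e + k * r) ≡ c + r * k + e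
    regroup = solve-∀

  private
    everything : VSet n
    everything _ = true

    AdjacentOrEqual : Fin n → Fin n → Set
    AdjacentOrEqual u v = u ≡ v ⊎ adj G u v ≡ true

    AdjacentOrEqual-sym : ∀ {u v} → AdjacentOrEqual u v → AdjacentOrEqual v u
    AdjacentOrEqual-sym (inj₁ refl) = inj₁ refl
    AdjacentOrEqual-sym {u} {v} (inj₂ a) = inj₂ (trans (adjℕ-sym (toℕ v) (toℕ u)) a)

    extendWalk : ∀ t x y z → reachWithin G everything t x y ≡ true → AdjacentOrEqual y z →
      reachWithin G everything (suc t) x z ≡ true
    extendWalk t x y z h (inj₁ refl) = reachWithin-suc G everything t x y h
    extendWalk t x y z h (inj₂ a)    = reachWithin-step G everything t x y z h a refl

    padWalk : ∀ d t u v → reachWithin G everything t u v ≡ true → reachWithin G everything (d + t) u v ≡ true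
    padWalk zero    t u v h = h
    padWalk (suc d) t u v h = reachWithin-suc G everything (d + t) u v (padWalk d t u v h)

    lastClique : Fin n
    lastClique = fromℕ< {k′} {n} (s≤s (m≤m+n k′ r))

    lastClique-inClique : inClique lastClique ≡ true
    lastClique-inClique =
      trans (cong (_<ᵇ k) (toℕ-fromℕ< (s≤s (m≤m+n k′ r)))) (<⇒<ᵇ-true (n<1+n k′))

    clique-AdjacentOrEqual : ∀ a b → inClique a ≡ true → inClique b ≡ true → AdjacentOrEqual a b
    clique-AdjacentOrEqual a b ha hb = decide (toℕ a ≡ᵇ toℕ b) refl
      where
      decide : ∀ x → (toℕ a ≡ᵇ toℕ b) ≡ x → AdjacentOrEqual a b
      decide true  a≡b = inj₁ (toℕ-injective (≡ᵇ-true⇒≡ (toℕ a) (toℕ b) a≡b))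
      decide false a≢b = inj₂ (trans (adj-clique-clique (toℕ a) (toℕ b) ha hb) (cong not a≢b))

  -- Vertex k - 1 sees every outside vertex: it is a hub when k ≥ 2, and it is vertex 0 with e = r when k = 1.
  module _ (lastIsHub : 1 ≤ k′ ⊎ e ≡ r) where
    private
      lastClique-sees : ∀ u → inClique u ≡ false → adj G u lastClique ≡ true
      lastClique-sees u out = trans (adj-outside-clique (toℕ u) (toℕ lastClique) out lastClique-inClique)
                                    (trans (cong (λ x → hubEdge x (toℕ u)) (toℕ-fromℕ< (s≤s (m≤m+n k′ r))))
                                           (hub lastIsHub))
        where
        hub : (1 ≤ k′ ⊎ e ≡ r) → hubEdge k′ (toℕ u) ≡ true
        hub (inj₁ (s≤s z≤n)) = refl
        hub (inj₂ refl)      = trans (cong ((0 <ᵇ k′) ∨_) (<⇒<ᵇ-true (toℕ<n u))) (∨-zeroʳ _)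

      nearClique : ∀ u → Σ (Fin n) (λ h → inClique h ≡ true × AdjacentOrEqual u h)
      nearClique u = decide (inClique u) refl
        where
        decide : ∀ b → inClique u ≡ b → Σ (Fin n) (λ h → inClique h ≡ true × AdjacentOrEqual u h)
        decide true  inside  = u , inside , inj₁ refl
        decide false outside = lastClique , lastClique-inClique , inj₂ (lastClique-sees u outside)

    connected : 2 ≤ r → Connected G
    connected 2≤r u v with nearClique u | nearClique v
    ... | hu , Ku , u~hu | hv , Kv , v~hv =
      subst (λ t → reachWithin G everything t u v ≡ true) (m∸n+n≡m 3≤n) (padWalk (n ∸ 3) 3 u v walk)
      where
      walk : reachWithin G everything 3 u v ≡ true
      walk = extendWalk 2 u hv v
               (extendWalk 1 u hu hv
                  (extendWalk 0 u u hu (reachWithin-refl G everything 0 u refl) u~hu)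
                  (clique-AdjacentOrEqual hu hv Ku Kv))
               (AdjacentOrEqual-sym v~hv)
      3≤n : 3 ≤ n
      3≤n = +-mono-≤ (s≤s (z≤n {k′})) 2≤r

  private
    outside : VSet n
    outside = minus inClique

    reachWithin-outside : ∀ t u v → reachWithin G outside t u v ≡ outside u ∧ (outside v ∧ (toℕ u ≡ᵇ toℕ v))
    reachWithin-outside zero    u v = refl
    reachWithin-outside (suc t) u v =
      trans (cong (reachWithin G outside t u v ∨_) (anyF-false _ noStep))
            (trans (∨-identityʳ _) (reachWithin-outside t u v))
      where
      noStep : ∀ w → reachWithin G outside t u w ∧ (adj G w v ∧ outside v) ≡ false
      noStep w rewrite reachWithin-outside t u w = decide (outside w) refl (outside v) refl
        where
        decide : ∀ a → outside w ≡ a → ∀ b → outside v ≡ b →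
          (outside u ∧ (outside w ∧ (toℕ u ≡ᵇ toℕ w))) ∧ (adj G w v ∧ outside v) ≡ false
        decide false ow b ov rewrite ow = cong (_∧ (adj G w v ∧ outside v)) (∧-zeroʳ (outside u))
        decide true  ow false ov rewrite ov =
          trans (cong ((outside u ∧ (outside w ∧ (toℕ u ≡ᵇ toℕ w))) ∧_) (∧-zeroʳ (adj G w v))) (∧-zeroʳ _)
        decide true  ow true  ov
          rewrite adj-outside-outside (toℕ w) (toℕ v) (not-true ow) (not-true ov) = ∧-zeroʳ _

  ω-outside : ω G outside ≡ r
  ω-outside = trans (count-cong allRepresentatives) count-outside
    where
    allRepresentatives : ∀ v → outside v ∧ not (anyF (λ u → (toℕ u <ᵇ toℕ v) ∧ reach G outside u v)) ≡ outside v
    allRepresentatives v = trans (cong (λ b → outside v ∧ not b) (anyF-false _ unreached)) (∧-identityʳ (outside v))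
      where
      unreached : ∀ u → (toℕ u <ᵇ toℕ v) ∧ reach G outside u v ≡ false
      unreached u rewrite reachWithin-outside n u v = decide (toℕ u <ᵇ toℕ v) refl
        where
        decide : ∀ b → (toℕ u <ᵇ toℕ v) ≡ b → b ∧ (outside u ∧ (outside v ∧ (toℕ u ≡ᵇ toℕ v))) ≡ false
        decide false _ = refl
        decide true  u<v rewrite <ᵇ-true⇒≡ᵇ-false (toℕ u) (toℕ v) u<v =
          trans (cong (outside u ∧_) (∧-zeroʳ (outside v))) (∧-zeroʳ (outside u))

  τ-outside : 1 ≤ r → τ G outside ≡ 1
  τ-outside 1≤r = ≤-antisym (maxF-least _ 1 singleton)
                            (τ-pos G outside (≤-trans 1≤r (≤-reflexive (sym count-outside))))
    where
    singleton : ∀ v → (if outside v then count (reach G outside v) else 0) ≤ 1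
    singleton v with outside v
    ... | false = z≤n
    ... | true  = ≤-trans (count-mono reach⇒≡ᵇ) (count-≡ᵇ≤1 v)
      where
      reach⇒≡ᵇ : ∀ u → reach G outside v u ≡ true → (toℕ v ≡ᵇ toℕ u) ≡ true
      reach⇒≡ᵇ u h = ∧-trueʳ (outside u) (∧-trueʳ (outside v) (trans (sym (reachWithin-outside n v u)) h))

  hasTenacity : 2 ≤ r → 1 ≤ e → e ≤ r → HasTenacity G (k + 1) r
  hasTenacity 2≤r 1≤e e≤r =
    tenacityLowerBound G k′ r refl many ,
    inClique , ≤-trans 2≤r (≤-reflexive (sym ω-outside)) , balanced
    where
    many : choose2 k + r * k′ < edgeCount G
    many = subst (choose2 k + r * k′ <_) (sym (edgeCount-G e≤r)) (m<m+n _ 1≤e)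
    balanced : (count inClique + τ G outside) * r ≡ (k + 1) * ω G outside
    balanced = trans (cong₂ (λ a b → (a + b) * r) count-inClique (τ-outside (≤-trans (s≤s z≤n) 2≤r)))
                     (cong ((k + 1) *_) (sym ω-outside))

record Excess (a r m : ℕ) : Set where
  field
    e   : ℕ
    m≡  : m ≡ a + e
    1≤e : 1 ≤ e
    e≤r : e ≤ r

excess : ∀ a r m → a < m → m ≤ a + r → Excess a r m
excess a r m a<m m≤a+r = record
  { e = m ∸ a ; m≡ = sym (m+[n∸m]≡n (<⇒≤ a<m)) ; 1≤e = m<n⇒0<n∸m a<m ; e≤r = m≤n+o⇒m∸n≤o m a m≤a+r }

-- With a single outside vertex the lower edge bound already exceeds C(k + 1, 2) - 1.
two≤outside : ∀ k′ r m → choose2 (suc k′) + r * k′ < m → m + 1 ≤ choose2 (suc k′ + r) → 1 ≤ r → 2 ≤ r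
two≤outside k′ (suc (suc r)) m _ _ _ = s≤s (s≤s z≤n)
two≤outside k′ 1 m many few _ = ⊥-elim (<-irrefl refl (begin-strict
  m + 1                           ≤⟨ few ⟩
  choose2 (suc k′ + 1)            ≡⟨ cong choose2 (+-comm (suc k′) 1) ⟩
  suc k′ + choose2 (suc k′)       ≡⟨ shuffle k′ (choose2 (suc k′)) ⟩
  suc (choose2 (suc k′) + 1 * k′) ≤⟨ many ⟩
  m                               <⟨ m<m+n m (s≤s z≤n) ⟩
  m + 1                           ∎))
  where
  open ≤-Reasoning
  shuffle : ∀ k c → suc k + c ≡ suc (c + 1 * k)
  shuffle = solve-∀

-- For k = 1 the bound n ≤ m + 1 forces vertex 0 to see all outside vertices.
lastIsHub : ∀ k′ r e → suc k′ + r ≤ choose2 (suc k′) + r * k′ + e + 1 → e ≤ r → 1 ≤ k′ ⊎ e ≡ r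
lastIsHub (suc k′) r e _ _ = inj₁ (s≤s z≤n)
lastIsHub zero r e n≤m+1 e≤r = inj₂ (≤-antisym e≤r (+-cancelʳ-≤ 1 r e (begin
  r + 1          ≡⟨ +-comm r 1 ⟩
  1 + r          ≤⟨ n≤m+1 ⟩
  r * 0 + e + 1  ≡⟨ cong (λ x → x + e + 1) (*-zeroʳ r) ⟩
  e + 1          ∎)))
  where open ≤-Reasoning

edgeRange : ∀ k′ r m → suc k′ C 2 + r * k′ < m → m ≤ suc k′ C 2 + r * suc k′ →
  Excess (choose2 (suc k′) + r * k′) r m
edgeRange k′ r m many few = excess _ r m
  (subst (λ c → c + r * k′ < m) (sym (choose2≡C2 (suc k′))) many)
  (subst (m ≤_) (trans (cong₂ _+_ (sym (choose2≡C2 (suc k′))) (*-suc r k′)) (regroup _ r (r * k′))) few)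
  where
  regroup : ∀ a r b → a + (r + b) ≡ a + b + r
  regroup = solve-∀

theorem1 : (n m k : ℕ) → 1 ≤ n → 1 ≤ m → n ≤ m + 1 → m + 1 ≤ n C 2 →
    k C 2 + (n ∸ k) * (k ∸ 1) < m → m ≤ k C 2 + (n ∸ k) * k →
    ((G : Graph n) → Connected G → edgeCount G ≡ m → TenacityGE G (k + 1) (n ∸ k))
    × Σ (Graph n) (λ G → Connected G × edgeCount G ≡ m × HasTenacity G (k + 1) (n ∸ k))
theorem1 n m zero     _ _ _     _       many few = ⊥-elim (<⇒≱ many few)
theorem1 n m (suc k′) _ _ n≤m+1 m+1≤nC2 many few =
  (λ G _ edges → tenacityLowerBound G k′ r n≡ (subst (A <_) (sym edges) A<m)) ,
  subst (λ N → Σ (Graph N) (λ G → Connected G × edgeCount G ≡ m × HasTenacity G (suc k′ + 1) r)) (sym n≡)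
    (G , connected hub 2≤r , trans (edgeCount-G e≤r) (sym m≡) , hasTenacity 2≤r 1≤e e≤r)
  where
  r = n ∸ suc k′
  A = choose2 (suc k′) + r * k′
  open Excess (edgeRange k′ r m many few)
  open Extremal k′ r e using (G; connected; edgeCount-G; hasTenacity)
  A<m : A < m
  A<m = subst (A <_) (sym m≡) (m<m+n A 1≤e)
  n≡ : n ≡ suc k′ + r
  n≡ = sym (m+[n∸m]≡n {suc k′} (<⇒≤ (m∸n≢0⇒n<m (λ r≡0 → <⇒≢ (≤-trans 1≤e e≤r) (sym r≡0)))))
  2≤r : 2 ≤ r
  2≤r = two≤outside k′ r m A<m (subst (m + 1 ≤_) (trans (sym (choose2≡C2 n)) (cong choose2 n≡)) m+1≤nC2)
                    (≤-trans 1≤e e≤r)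
  hub : 1 ≤ k′ ⊎ e ≡ r
  hub = lastIsHub k′ r e (subst₂ (λ N M → N ≤ M + 1) n≡ m≡ n≤m+1) e≤r
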